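{- There is no $\lambda\mu$-term $\mathtt{Por}$ such that, for all $\lambda\mu$-terms $M,N$: - $\mathtt{Por}\langle M,N\rangle\equiv_{\mathcal T}\mathtt{True}$ whenever $M\not\equiv_{\mathcal T}\Omega$ or $N\not\equiv_{\mathcal T}\Omega$, and - $\mathtt{Por}\langle M,N\rangle\equiv_{\mathcal T}\Omega$ whenever $M\equiv_{\mathcal T}N\equiv_{\mathcal T}\Omega$.
   Context: Fix disjoint countably infinite sets of variables and names. $\lambda\mu$-terms: $M::=x\mid\lambda x.M\mid MM\mid\mu\alpha.{}_\beta|M|$, up to renaming of bound variables and names. Notation: $\mathtt{True}:=\lambda x y.x$, $\Omega:=(\lambda x.xx)(\lambda x.xx)$, and $\langle M,N\rangle:=\lambda z.zMN$ with $z$ fresh. Resource terms and sums. - Resource terms: $t::=x\mid\lambda x.t\mid t[t_1,\dots,t_n]\mid\mu\alpha.{}_\beta|t|$, with bags finite multisets; $1$ is the empty bag and $*$ is union. - Sums are finite sets with idempotent $+$ and empty sum $0$; constructors extend multilinearly, and $0$ annihilates. - A weak composition (w.c.) of a bag $B$ is a tuple of possibly empty bags whose union is $B$. Linear substitution $t\langle B/x\rangle$: - $x\langle[v]/x\rangle=v$, and $x\langle B/x\rangle=0$ otherwise. - For $y\ne x$: $y\langle1/x\rangle=y$, and $y\langle B/x\rangle=0$ if $B\ne1$. - It commutes with $\lambda y$ and with $\mu\alpha.{}_\beta|\cdot|$. - $(t[v_1..v_n])\langle B/x\rangle=\sum_{(B_0..B_n)\text{ w.c.}}t\langle B_0/x\rangle[v_i\langle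 B_i/x\rangle]_i$. Linear named application $\langle t\rangle_\alpha B$: - $\langle x\rangle_\alpha1=x$, and $\langle x\rangle_\alpha B=0$ if $B\ne1$. - It commutes with $\lambda y$ and with $\mu\gamma$. - $\langle{}_\eta|t|\rangle_\alpha B={}_\eta|\langle t\rangle_\alpha B|$ ($\eta\ne\alpha$), and $\langle{}_\alpha|t|\rangle_\alpha B=\sum_{(B_1,B_2)\text{ w.c.}}{}_\alpha|(\langle t\rangle_\alpha B_1)B_2|$. - $\langle t[v_1..v_n]\rangle_\alpha B=\sum_{(B_0..B_n)}(\langle t\rangle_\alpha B_0)[\langle v_i\rangle_\alpha B_i]_i$. Resource reduction. $\to_r$ is the closure under single-hole resource contexts of $(\lambda x.t)B\to t\langle B/x\rangle$, $(\mu\alpha.{}_\beta|t|)B\to\mu\alpha.\langle{}_\beta|t|\rangle_\alpha B$, and $\mu\gamma.{}_\alpha|\mu\beta.{}_\eta|t||\to\mu\gamma.({}_\eta|t|)\{\alpha/\beta\}$, extended to sums by $t+\mathcal S\to_r\mathcal T+\mathcal S$ if $t\to_r\mathcal T$ and $t\notin\mathcal S$. It is confluent and strongly normalising; $\mathrm{nf}_r(t)$ is the normal form of $t$. Taylor expansion. - $\mathcal T(x)=\{x\}$, $\mathcal T(\lambda x.M)=\{\lambda x.t\mid t\in\mathcal T(M)\}$, $\mathcal T(\mu\alpha.{}_\beta|M|)=\{\mu\alpha.{}_\beta|t|\mid t\in\mathcal T(M)\}$. - $\mathcal T(MN)=\{t[u_1..u_n]\mid t\in\mathcal T(M),n\ge0,u_i\in\mathcal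 T(N)\}$. - $\mathrm{NF}(\mathcal T(M))=\bigcup_{t\in\mathcal T(M)}\mathrm{nf}_r(t)$. - $M\equiv_{\mathcal T}N$ iff $\mathrm{NF}(\mathcal T(M))=\mathrm{NF}(\mathcal T(N))$. -}

module Defs where

open import Data.Nat using (ℕ; zero; suc; _≡ᵇ_)
open import Data.Bool using (if_then_else_)
open import Data.Maybe using (Maybe; just; nothing)
import Data.Maybe as Maybe
open import Data.List using (List; []; _∷_; _++_; map; concatMap; length; replicate; [_])
open import Data.List.Membership.Propositional using (_∈_)
open import Data.List.Relation.Unary.All using (All)
open import Data.Product using (Σ; _×_; ∃; _,_)
open import Relation.Nullary using (¬_)
open import Relation.Binary.Construct.Closure.ReflexiveTransitive using (Star)
open import Function.Bundles using (_⇔_)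

-- λμ-terms, locally nameless-free de Bruijn encoding (two sorts:
-- variables bound by λ, names bound by μ), so terms are automatically
-- identified up to renaming of bound variables and names.
--   lam M      = λx.M      (x = variable index 0 in M)
--   mu β M     = μα.β|M|   (α = name index 0 in β and in M)

data Term : Set where
  var : ℕ → Term
  lam : Term → Term
  app : Term → Term → Term
  mu  : ℕ → Term → Term

liftR : (ℕ → ℕ) → ℕ → ℕ
liftR ρ zero = zero
liftR ρ (suc k) = suc (ρ k)

renT : (ℕ → ℕ) → Term → Term
renT ρ (var x) = var (ρ x)
renT ρ (lam M) = lam (renT (liftR ρ) M)
renT ρ (app M N) = app (renT ρ M) (renT ρ N)
renT ρ (mu β M) = mu β (renT ρ M)

True : Term
True = lam (lam (var 1))

δ : Term
δ = lam (app (var 0) (var 0))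

Ω : Term
Ω = app δ δ

-- ⟨M,N⟩ = λz.zMN with z fresh
pair : Term → Term → Term
pair M N = lam (app (app (var 0) (renT suc M)) (renT suc N))

-- Resource terms; bags are lists, considered up to permutation (≈ below);
-- sums are lists, considered as finite sets (only membership is used).

data RTerm : Set where
  rvar : ℕ → RTerm
  rlam : RTerm → RTerm
  rapp : RTerm → List RTerm → RTerm
  rmu  : ℕ → RTerm → RTerm

Sum : Set
Sum = List RTerm

mutual
  renV : (ℕ → ℕ) → RTerm → RTerm
  renV ρ (rvar k) = rvar (ρ k)
  renV ρ (rlam t) = rlam (renV (liftR ρ) t)
  renV ρ (rapp t vs) = rapp (renV ρ t) (renVs ρ vs)
  renV ρ (rmu β t) = rmu β (renV ρ t)

  renVs : (ℕ → ℕ) → List RTerm → List RTerm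
  renVs ρ [] = []
  renVs ρ (v ∷ vs) = renV ρ v ∷ renVs ρ vs

mutual
  renN : (ℕ → ℕ) → RTerm → RTerm
  renN σ (rvar k) = rvar k
  renN σ (rlam t) = rlam (renN σ t)
  renN σ (rapp t vs) = rapp (renN σ t) (renNs σ vs)
  renN σ (rmu β t) = rmu (liftR σ β) (renN (liftR σ) t)

  renNs : (ℕ → ℕ) → List RTerm → List RTerm
  renNs σ [] = []
  renNs σ (v ∷ vs) = renN σ v ∷ renNs σ vs

-- weak compositions of a bag into n parts (all assignments of elements
-- to parts; repetitions are harmless since sums are idempotent)
insertEach : {A : Set} → A → List (List A) → List (List (List A))
insertEach b [] = []
insertEach b (c ∷ cs) = ((b ∷ c) ∷ cs) ∷ map (c ∷_) (insertEach b cs)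

wc : {A : Set} → ℕ → List A → List (List (List A))
wc n [] = [ replicate n [] ]
wc n (b ∷ bs) = concatMap (insertEach b) (wc n bs)

dropVar : ℕ → ℕ → Maybe ℕ
dropVar zero zero = nothing
dropVar zero (suc k) = just k
dropVar (suc x) zero = just zero
dropVar (suc x) (suc k) = Maybe.map suc (dropVar x k)

varCase : Maybe ℕ → List RTerm → Sum
varCase nothing (v ∷ []) = v ∷ []
varCase nothing _ = []
varCase (just k) [] = rvar k ∷ []
varCase (just k) (_ ∷ _) = []

-- Linear substitution  t⟨B/x⟩  (x a de Bruijn variable index; the bound
-- variable is removed, i.e. free variables above x are decremented)

mutual
  lsubst : ℕ → List RTerm → RTerm → Sum
  lsubst x B (rvar k) = varCase (dropVar x k) B
  lsubst x B (rlam t) = map rlam (lsubst (suc x) (renVs suc B) t)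
  lsubst x B (rmu β t) = map (rmu β) (lsubst x (renNs suc B) t)
  lsubst x B (rapp t vs) = lsubstApp x t vs (wc (suc (length vs)) B)

  lsubstApp : ℕ → RTerm → List RTerm → List (List (List RTerm)) → Sum
  lsubstApp x t vs [] = []
  lsubstApp x t vs ([] ∷ cs) = lsubstApp x t vs cs
  lsubstApp x t vs ((B0 ∷ Bs) ∷ cs) =
    concatMap (λ t' → map (rapp t') (lsubstBag x Bs vs)) (lsubst x B0 t)
    ++ lsubstApp x t vs cs

  lsubstBag : ℕ → List (List RTerm) → List RTerm → List (List RTerm)
  lsubstBag x [] [] = [] ∷ []
  lsubstBag x (Bi ∷ Bs) (v ∷ vs) =
    concatMap (λ v' → map (v' ∷_) (lsubstBag x Bs vs)) (lsubst x Bi v)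
  lsubstBag x _ _ = []

mutual
  napp : ℕ → List RTerm → RTerm → Sum
  napp α B (rvar k) = varCase (just k) B
  napp α B (rlam t) = map rlam (napp α (renVs suc B) t)
  napp α B (rmu η t) = map (rmu η) (nappCmd (suc α) (renNs suc B) η t)
  napp α B (rapp t vs) = nappApp α t vs (wc (suc (length vs)) B)

  -- ⟨η|t|⟩_α B, returning the bodies (the name η is unchanged)
  nappCmd : ℕ → List RTerm → ℕ → RTerm → Sum
  nappCmd α B η t =
    if η ≡ᵇ α then nappNamed α t (wc 2 B) else napp α B t

  nappNamed : ℕ → RTerm → List (List (List RTerm)) → Sum
  nappNamed α t [] = []
  nappNamed α t ((B1 ∷ B2 ∷ []) ∷ cs) =
    map (λ t' → rapp t' B2) (napp α B1 t) ++ nappNamed α t cs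
  nappNamed α t (_ ∷ cs) = nappNamed α t cs

  nappApp : ℕ → RTerm → List RTerm → List (List (List RTerm)) → Sum
  nappApp α t vs [] = []
  nappApp α t vs ([] ∷ cs) = nappApp α t vs cs
  nappApp α t vs ((B0 ∷ Bs) ∷ cs) =
    concatMap (λ t' → map (rapp t') (nappBag α Bs vs)) (napp α B0 t)
    ++ nappApp α t vs cs

  nappBag : ℕ → List (List RTerm) → List RTerm → List (List RTerm)
  nappBag α [] [] = [] ∷ []
  nappBag α (Bi ∷ Bs) (v ∷ vs) =
    concatMap (λ v' → map (v' ∷_) (nappBag α Bs vs)) (napp α Bi v)
  nappBag α _ _ = []

-- name substitution for μγ.α|μβ.η|t|| → μγ.(η|t|){α/β}:
-- inner name 0 (β) ↦ α, inner name k+1 ↦ k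
renameσ : ℕ → ℕ → ℕ
renameσ α zero = α
renameσ α (suc k) = k

infix 4 _⟶_ _⟶s_

data _⟶_ : RTerm → Sum → Set where
  βλ   : ∀ {t B} → rapp (rlam t) B ⟶ lsubst 0 B t
  βμ   : ∀ {β t B} → rapp (rmu β t) B ⟶ map (rmu β) (nappCmd 0 (renNs suc B) β t)
  ρμ   : ∀ {α η t} → rmu α (rmu η t) ⟶ rmu (renameσ α η) (renN (renameσ α) t) ∷ []
  lamC : ∀ {t S} → t ⟶ S → rlam t ⟶ map rlam S
  muC  : ∀ {β t S} → t ⟶ S → rmu β t ⟶ map (rmu β) S
  appL : ∀ {t S B} → t ⟶ S → rapp t B ⟶ map (λ t' → rapp t' B) S
  appR : ∀ {t v S B1 B2} → v ⟶ S →
         rapp t (B1 ++ v ∷ B2) ⟶ map (λ v' → rapp t (B1 ++ v' ∷ B2)) S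

data _⟶s_ : Sum → Sum → Set where
  step : ∀ {xs t T ys} → t ⟶ T → (xs ++ t ∷ ys) ⟶s (xs ++ T ++ ys)

NormalSum : Sum → Set
NormalSum S = All (λ t → ∀ T → ¬ (t ⟶ T)) S

mutual
  data _≈_ : RTerm → RTerm → Set where
    rvar≈ : ∀ {k} → rvar k ≈ rvar k
    rlam≈ : ∀ {t u} → t ≈ u → rlam t ≈ rlam u
    rmu≈  : ∀ {β t u} → t ≈ u → rmu β t ≈ rmu β u
    rapp≈ : ∀ {t u B C} → t ≈ u → B ≈B C → rapp t B ≈ rapp u C

  data _≈B_ : List RTerm → List RTerm → Set where
    []≈ : [] ≈B []
    ∷≈  : ∀ {x y xs ys1 ys2} → x ≈ y → xs ≈B (ys1 ++ ys2) →
          (x ∷ xs) ≈B (ys1 ++ y ∷ ys2)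

data _∈T_ : RTerm → Term → Set where
  Tvar : ∀ {x} → rvar x ∈T var x
  Tlam : ∀ {t M} → t ∈T M → rlam t ∈T lam M
  Tmu  : ∀ {β t M} → t ∈T M → rmu β t ∈T mu β M
  Tapp : ∀ {t us M N} → t ∈T M → All (_∈T N) us → rapp t us ∈T app M N

_∈nf_ : RTerm → RTerm → Set
u ∈nf t = Σ Sum λ S → Star _⟶s_ (t ∷ []) S × NormalSum S × u ∈ S

NFT : Term → RTerm → Set
NFT M u = ∃ λ t → t ∈T M × ∃ λ u' → u' ∈nf t × u' ≈ u

_≡T_ : Term → Term → Set
M ≡T N = ∀ u → NFT M u ⇔ NFT N u

-- Take M = x (a free variable) and N = Ω. Every element of T(Ω) has the shape
-- (λx.x[x,…,x])[δ₁,…,δₙ] with each δᵢ ∈ T(λx.xx); reduction preserves this shape and it is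
-- never normal, so NF(T(Ω)) is empty and x ≢ Ω. Hence Por⟨x,Ω⟩ ≡ True, so λxy.x arises as a
-- normal form of some p[B] ∈ T(Por⟨x,Ω⟩). Resource reduction is linear: it never erases an
-- occurrence of a free variable, so x occurs nowhere in p[B]. The elements of B are then of the
-- form λz.z[][…], which also lie in T⟨Ω,Ω⟩; thus λxy.x ∈ NF(T(Por⟨Ω,Ω⟩)) = NF(T(Ω)) = ∅.

module Submission where

open import Defs
open import Data.Bool using (true; false)
open import Data.Empty using (⊥-elim)
open import Data.List using (List; []; _∷_; _++_; map; concatMap; length)
open import Data.List.Relation.Unary.All as All using (All; []; _∷_; universal)
open import Data.List.Relation.Unary.All.Properties using (map⁺; gmap⁺; ++⁺; ++⁻; concat⁺; replicate⁺)
open import Data.List.Relation.Unary.Any using (Any; here; there)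
open import Data.List.Relation.Unary.Any.Properties using () renaming (++⁻ to Any-++⁻; ++⁺ˡ to Any-++⁺ˡ; ++⁺ʳ to Any-++⁺ʳ)
import Data.Maybe as Maybe
open import Data.Maybe using (just; nothing)
open import Data.Nat using (ℕ; suc; _≡ᵇ_)
open import Data.Product using (∃; _×_; _,_; proj₁; proj₂)
open import Data.Sum using (_⊎_; inj₁; inj₂)
open import Function using (id; _∘_)
open import Function.Bundles using (mk⇔; Equivalence)
open import Relation.Binary.Construct.Closure.ReflexiveTransitive using (Star; ε; _◅_)
open import Relation.Binary.PropositionalEquality using (_≡_; refl; cong)
open import Relation.Nullary using (¬_)

module _ {A B : Set} {Q : B → Set} where

  universal-map : {f : A → B} → (∀ x → Q (f x)) → ∀ xs → All Q (map f xs)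
  universal-map g xs = map⁺ (universal g xs)

  concatMap⁺ : ∀ {P : A → Set} {f : A → List B} {xs} →
               All P xs → (∀ {x} → P x → All Q (f x)) → All Q (concatMap f xs)
  concatMap⁺ ps g = concat⁺ (gmap⁺ g ps)

  universal-concatMap : {f : A → List B} → (∀ x → All Q (f x)) → ∀ xs → All Q (concatMap f xs)
  universal-concatMap g xs = concat⁺ (map⁺ (universal g xs))

module _ {A : Set} {P : A → Set} where

  insertEach-inserts : ∀ {b} → P b → ∀ c' → All (Any (Any P)) (insertEach b c')
  insertEach-inserts p [] = []
  insertEach-inserts p (c ∷ cs) = here (here p) ∷ gmap⁺ there (insertEach-inserts p cs)

  insertEach-keeps : ∀ b {c'} → Any (Any P) c' → All (Any (Any P)) (insertEach b c')
  insertEach-keeps b {c ∷ cs} (here q) = here (there q) ∷ universal-map (λ _ → here q) (insertEach b cs)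
  insertEach-keeps b (there a) = there a ∷ gmap⁺ there (insertEach-keeps b a)

  insertEach-All : ∀ {b c'} → P b → All (All P) c' → All (All (All P)) (insertEach b c')
  insertEach-All p [] = []
  insertEach-All p (a ∷ as) = ((p ∷ a) ∷ as) ∷ gmap⁺ (a ∷_) (insertEach-All p as)

  wc-covers : ∀ {B} → Any P B → ∀ n → All (Any (Any P)) (wc n B)
  wc-covers {b ∷ bs} (here p) n = universal-concatMap (insertEach-inserts p) (wc n bs)
  wc-covers {b ∷ bs} (there a) n = concatMap⁺ (wc-covers a n) (insertEach-keeps b)

  wc-All : ∀ {B} → All P B → ∀ n → All (All (All P)) (wc n B)
  wc-All [] n = replicate⁺ n [] ∷ []
  wc-All (p ∷ ps) n = concatMap⁺ (wc-All ps n) (insertEach-All p)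

data Occ : ℕ → RTerm → Set where
  ovar  : ∀ {k} → Occ k (rvar k)
  olam  : ∀ {k t} → Occ (suc k) t → Occ k (rlam t)
  omu   : ∀ {k β t} → Occ k t → Occ k (rmu β t)
  oappL : ∀ {k t B} → Occ k t → Occ k (rapp t B)
  oappR : ∀ {k t B} → Any (Occ k) B → Occ k (rapp t B)

mutual
  Occ-renV : ∀ ρ {k t} → Occ k t → Occ (ρ k) (renV ρ t)
  Occ-renV ρ ovar = ovar
  Occ-renV ρ (olam o) = olam (Occ-renV (liftR ρ) o)
  Occ-renV ρ (omu o) = omu (Occ-renV ρ o)
  Occ-renV ρ (oappL o) = oappL (Occ-renV ρ o)
  Occ-renV ρ (oappR a) = oappR (Occ-renVs ρ a)

  Occ-renVs : ∀ ρ {k B} → Any (Occ k) B → Any (Occ (ρ k)) (renVs ρ B)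
  Occ-renVs ρ (here o) = here (Occ-renV ρ o)
  Occ-renVs ρ (there a) = there (Occ-renVs ρ a)

mutual
  Occ-renN : ∀ σ {k t} → Occ k t → Occ k (renN σ t)
  Occ-renN σ ovar = ovar
  Occ-renN σ (olam o) = olam (Occ-renN σ o)
  Occ-renN σ (omu o) = omu (Occ-renN (liftR σ) o)
  Occ-renN σ (oappL o) = oappL (Occ-renN σ o)
  Occ-renN σ (oappR a) = oappR (Occ-renNs σ a)

  Occ-renNs : ∀ σ {k B} → Any (Occ k) B → Any (Occ k) (renNs σ B)
  Occ-renNs σ (here o) = here (Occ-renN σ o)
  Occ-renNs σ (there a) = there (Occ-renNs σ a)

Occ-varCase-just : ∀ k B → All (Occ k) (varCase (just k) B)
Occ-varCase-just k [] = ovar ∷ []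
Occ-varCase-just k (_ ∷ _) = []

Occ-varCase-bag : ∀ {k} mk B → Any (Occ k) B → All (Occ k) (varCase mk B)
Occ-varCase-bag nothing (_ ∷ []) (here o) = o ∷ []
Occ-varCase-bag nothing (_ ∷ _ ∷ _) a = []
Occ-varCase-bag (just _) (_ ∷ _) a = []

mutual
  Occ-lsubst-term : ∀ x B t {k k'} → Occ k t → dropVar x k ≡ just k' → All (Occ k') (lsubst x B t)
  Occ-lsubst-term x B (rvar _) {k' = k'} ovar eq rewrite eq = Occ-varCase-just k' B
  Occ-lsubst-term x B (rlam t) (olam o) eq =
    gmap⁺ olam (Occ-lsubst-term (suc x) (renVs suc B) t o (cong (Maybe.map suc) eq))
  Occ-lsubst-term x B (rmu β t) (omu o) eq = gmap⁺ omu (Occ-lsubst-term x (renNs suc B) t o eq)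
  Occ-lsubst-term x B (rapp t vs) o eq = Occ-lsubstApp-term x t vs (wc (suc (length vs)) B) o eq

  Occ-lsubstApp-term : ∀ x t vs cs {k k'} → Occ k (rapp t vs) → dropVar x k ≡ just k' →
                       All (Occ k') (lsubstApp x t vs cs)
  Occ-lsubstApp-term x t vs [] o eq = []
  Occ-lsubstApp-term x t vs ([] ∷ cs) o eq = Occ-lsubstApp-term x t vs cs o eq
  Occ-lsubstApp-term x t vs ((B0 ∷ Bs) ∷ cs) o@(oappL o₀) eq =
    ++⁺ (concatMap⁺ (Occ-lsubst-term x B0 t o₀ eq)
                    (λ o' → universal-map (λ _ → oappL o') (lsubstBag x Bs vs)))
        (Occ-lsubstApp-term x t vs cs o eq)
  Occ-lsubstApp-term x t vs ((B0 ∷ Bs) ∷ cs) o@(oappR a) eq =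
    ++⁺ (universal-concatMap (λ _ → gmap⁺ oappR (Occ-lsubstBag-term x Bs vs a eq)) (lsubst x B0 t))
        (Occ-lsubstApp-term x t vs cs o eq)

  Occ-lsubstBag-term : ∀ x Bs vs {k k'} → Any (Occ k) vs → dropVar x k ≡ just k' →
                       All (Any (Occ k')) (lsubstBag x Bs vs)
  Occ-lsubstBag-term x [] (_ ∷ _) a eq = []
  Occ-lsubstBag-term x (Bi ∷ Bs) (v ∷ vs) (here o) eq =
    concatMap⁺ (Occ-lsubst-term x Bi v o eq) (λ o' → universal-map (λ _ → here o') (lsubstBag x Bs vs))
  Occ-lsubstBag-term x (Bi ∷ Bs) (v ∷ vs) (there a) eq =
    universal-concatMap (λ _ → gmap⁺ there (Occ-lsubstBag-term x Bs vs a eq)) (lsubst x Bi v)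

mutual
  Occ-lsubst-bag : ∀ x B t {k} → Any (Occ k) B → All (Occ k) (lsubst x B t)
  Occ-lsubst-bag x B (rvar j) a = Occ-varCase-bag (dropVar x j) B a
  Occ-lsubst-bag x B (rlam t) a = gmap⁺ olam (Occ-lsubst-bag (suc x) (renVs suc B) t (Occ-renVs suc a))
  Occ-lsubst-bag x B (rmu β t) a = gmap⁺ omu (Occ-lsubst-bag x (renNs suc B) t (Occ-renNs suc a))
  Occ-lsubst-bag x B (rapp t vs) a =
    Occ-lsubstApp-bag x t vs (wc (suc (length vs)) B) (wc-covers a (suc (length vs)))

  Occ-lsubstApp-bag : ∀ x t vs cs {k} → All (Any (Any (Occ k))) cs → All (Occ k) (lsubstApp x t vs cs)
  Occ-lsubstApp-bag x t vs [] as = []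
  Occ-lsubstApp-bag x t vs ([] ∷ cs) (_ ∷ as) = Occ-lsubstApp-bag x t vs cs as
  Occ-lsubstApp-bag x t vs ((B0 ∷ Bs) ∷ cs) (here a ∷ as) =
    ++⁺ (concatMap⁺ (Occ-lsubst-bag x B0 t a)
                    (λ o' → universal-map (λ _ → oappL o') (lsubstBag x Bs vs)))
        (Occ-lsubstApp-bag x t vs cs as)
  Occ-lsubstApp-bag x t vs ((B0 ∷ Bs) ∷ cs) (there a ∷ as) =
    ++⁺ (universal-concatMap (λ _ → gmap⁺ oappR (Occ-lsubstBag-bag x Bs vs a)) (lsubst x B0 t))
        (Occ-lsubstApp-bag x t vs cs as)

  Occ-lsubstBag-bag : ∀ x Bs vs {k} → Any (Any (Occ k)) Bs → All (Any (Occ k)) (lsubstBag x Bs vs)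
  Occ-lsubstBag-bag x (Bi ∷ Bs) [] a = []
  Occ-lsubstBag-bag x (Bi ∷ Bs) (v ∷ vs) (here a) =
    concatMap⁺ (Occ-lsubst-bag x Bi v a) (λ o' → universal-map (λ _ → here o') (lsubstBag x Bs vs))
  Occ-lsubstBag-bag x (Bi ∷ Bs) (v ∷ vs) (there a) =
    universal-concatMap (λ _ → gmap⁺ there (Occ-lsubstBag-bag x Bs vs a)) (lsubst x Bi v)

mutual
  Occ-napp-term : ∀ α B t {k} → Occ k t → All (Occ k) (napp α B t)
  Occ-napp-term α B (rvar k) ovar = Occ-varCase-just k B
  Occ-napp-term α B (rlam t) (olam o) = gmap⁺ olam (Occ-napp-term α (renVs suc B) t o)
  Occ-napp-term α B (rmu η t) (omu o) = gmap⁺ omu (Occ-nappCmd-term (suc α) (renNs suc B) η t o)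
  Occ-napp-term α B (rapp t vs) o = Occ-nappApp-term α t vs (wc (suc (length vs)) B) o

  Occ-nappCmd-term : ∀ α B η t {k} → Occ k t → All (Occ k) (nappCmd α B η t)
  Occ-nappCmd-term α B η t o with η ≡ᵇ α
  ... | true = Occ-nappNamed-term α t (wc 2 B) o
  ... | false = Occ-napp-term α B t o

  Occ-nappNamed-term : ∀ α t cs {k} → Occ k t → All (Occ k) (nappNamed α t cs)
  Occ-nappNamed-term α t [] o = []
  Occ-nappNamed-term α t ((B1 ∷ B2 ∷ []) ∷ cs) o =
    ++⁺ (gmap⁺ oappL (Occ-napp-term α B1 t o)) (Occ-nappNamed-term α t cs o)
  Occ-nappNamed-term α t ([] ∷ cs) o = Occ-nappNamed-term α t cs o
  Occ-nappNamed-term α t ((_ ∷ []) ∷ cs) o = Occ-nappNamed-term α t cs o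
  Occ-nappNamed-term α t ((_ ∷ _ ∷ _ ∷ _) ∷ cs) o = Occ-nappNamed-term α t cs o

  Occ-nappApp-term : ∀ α t vs cs {k} → Occ k (rapp t vs) → All (Occ k) (nappApp α t vs cs)
  Occ-nappApp-term α t vs [] o = []
  Occ-nappApp-term α t vs ([] ∷ cs) o = Occ-nappApp-term α t vs cs o
  Occ-nappApp-term α t vs ((B0 ∷ Bs) ∷ cs) o@(oappL o₀) =
    ++⁺ (concatMap⁺ (Occ-napp-term α B0 t o₀) (λ o' → universal-map (λ _ → oappL o') (nappBag α Bs vs)))
        (Occ-nappApp-term α t vs cs o)
  Occ-nappApp-term α t vs ((B0 ∷ Bs) ∷ cs) o@(oappR a) =
    ++⁺ (universal-concatMap (λ _ → gmap⁺ oappR (Occ-nappBag-term α Bs vs a)) (napp α B0 t))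
        (Occ-nappApp-term α t vs cs o)

  Occ-nappBag-term : ∀ α Bs vs {k} → Any (Occ k) vs → All (Any (Occ k)) (nappBag α Bs vs)
  Occ-nappBag-term α [] (_ ∷ _) a = []
  Occ-nappBag-term α (Bi ∷ Bs) (v ∷ vs) (here o) =
    concatMap⁺ (Occ-napp-term α Bi v o) (λ o' → universal-map (λ _ → here o') (nappBag α Bs vs))
  Occ-nappBag-term α (Bi ∷ Bs) (v ∷ vs) (there a) =
    universal-concatMap (λ _ → gmap⁺ there (Occ-nappBag-term α Bs vs a)) (napp α Bi v)

mutual
  Occ-napp-bag : ∀ α B t {k} → Any (Occ k) B → All (Occ k) (napp α B t)
  Occ-napp-bag α (_ ∷ _) (rvar j) a = []
  Occ-napp-bag α B (rlam t) a = gmap⁺ olam (Occ-napp-bag α (renVs suc B) t (Occ-renVs suc a))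
  Occ-napp-bag α B (rmu η t) a = gmap⁺ omu (Occ-nappCmd-bag (suc α) (renNs suc B) η t (Occ-renNs suc a))
  Occ-napp-bag α B (rapp t vs) a =
    Occ-nappApp-bag α t vs (wc (suc (length vs)) B) (wc-covers a (suc (length vs)))

  Occ-nappCmd-bag : ∀ α B η t {k} → Any (Occ k) B → All (Occ k) (nappCmd α B η t)
  Occ-nappCmd-bag α B η t a with η ≡ᵇ α
  ... | true = Occ-nappNamed-bag α t (wc 2 B) (wc-covers a 2)
  ... | false = Occ-napp-bag α B t a

  Occ-nappNamed-bag : ∀ α t cs {k} → All (Any (Any (Occ k))) cs → All (Occ k) (nappNamed α t cs)
  Occ-nappNamed-bag α t [] as = []
  Occ-nappNamed-bag α t ((B1 ∷ B2 ∷ []) ∷ cs) (here a ∷ as) =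
    ++⁺ (gmap⁺ oappL (Occ-napp-bag α B1 t a)) (Occ-nappNamed-bag α t cs as)
  Occ-nappNamed-bag α t ((B1 ∷ B2 ∷ []) ∷ cs) (there (here a) ∷ as) =
    ++⁺ (universal-map (λ _ → oappR a) (napp α B1 t)) (Occ-nappNamed-bag α t cs as)
  Occ-nappNamed-bag α t ([] ∷ cs) (_ ∷ as) = Occ-nappNamed-bag α t cs as
  Occ-nappNamed-bag α t ((_ ∷ []) ∷ cs) (_ ∷ as) = Occ-nappNamed-bag α t cs as
  Occ-nappNamed-bag α t ((_ ∷ _ ∷ _ ∷ _) ∷ cs) (_ ∷ as) = Occ-nappNamed-bag α t cs as

  Occ-nappApp-bag : ∀ α t vs cs {k} → All (Any (Any (Occ k))) cs → All (Occ k) (nappApp α t vs cs)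
  Occ-nappApp-bag α t vs [] as = []
  Occ-nappApp-bag α t vs ([] ∷ cs) (_ ∷ as) = Occ-nappApp-bag α t vs cs as
  Occ-nappApp-bag α t vs ((B0 ∷ Bs) ∷ cs) (here a ∷ as) =
    ++⁺ (concatMap⁺ (Occ-napp-bag α B0 t a) (λ o' → universal-map (λ _ → oappL o') (nappBag α Bs vs)))
        (Occ-nappApp-bag α t vs cs as)
  Occ-nappApp-bag α t vs ((B0 ∷ Bs) ∷ cs) (there a ∷ as) =
    ++⁺ (universal-concatMap (λ _ → gmap⁺ oappR (Occ-nappBag-bag α Bs vs a)) (napp α B0 t))
        (Occ-nappApp-bag α t vs cs as)

  Occ-nappBag-bag : ∀ α Bs vs {k} → Any (Any (Occ k)) Bs → All (Any (Occ k)) (nappBag α Bs vs)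
  Occ-nappBag-bag α (Bi ∷ Bs) [] a = []
  Occ-nappBag-bag α (Bi ∷ Bs) (v ∷ vs) (here a) =
    concatMap⁺ (Occ-napp-bag α Bi v a) (λ o' → universal-map (λ _ → here o') (nappBag α Bs vs))
  Occ-nappBag-bag α (Bi ∷ Bs) (v ∷ vs) (there a) =
    universal-concatMap (λ _ → gmap⁺ there (Occ-nappBag-bag α Bs vs a)) (napp α Bi v)

Occ-⟶ : ∀ {k t T} → Occ k t → t ⟶ T → All (Occ k) T
Occ-⟶ (oappL (olam o)) (βλ {t} {B}) = Occ-lsubst-term 0 B t o refl
Occ-⟶ (oappR a) (βλ {t} {B}) = Occ-lsubst-bag 0 B t a
Occ-⟶ (oappL (omu o)) (βμ {β} {t} {B}) = gmap⁺ omu (Occ-nappCmd-term 0 (renNs suc B) β t o)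
Occ-⟶ (oappR a) (βμ {β} {t} {B}) = gmap⁺ omu (Occ-nappCmd-bag 0 (renNs suc B) β t (Occ-renNs suc a))
Occ-⟶ (omu (omu o)) ρμ = omu (Occ-renN _ o) ∷ []
Occ-⟶ (olam o) (lamC r) = gmap⁺ olam (Occ-⟶ o r)
Occ-⟶ (omu o) (muC r) = gmap⁺ omu (Occ-⟶ o r)
Occ-⟶ (oappL o) (appL r) = gmap⁺ oappL (Occ-⟶ o r)
Occ-⟶ (oappR a) (appL {S = S} r) = universal-map (λ _ → oappR a) S
Occ-⟶ (oappL o) (appR {S = S} r) = universal-map (λ _ → oappL o) S
Occ-⟶ (oappR a) (appR {S = S} {B1} r) with Any-++⁻ B1 a
... | inj₁ a₁ = universal-map (λ _ → oappR (Any-++⁺ˡ a₁)) S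
... | inj₂ (here o) = gmap⁺ (λ o' → oappR (Any-++⁺ʳ B1 (here o'))) (Occ-⟶ o r)
... | inj₂ (there a₂) = universal-map (λ _ → oappR (Any-++⁺ʳ B1 (there a₂))) S

module _ {P : RTerm → Set} (preserved : ∀ {t T} → P t → t ⟶ T → All P T) where

  preserved-⟶s : ∀ {S S'} → All P S → S ⟶s S' → All P S'
  preserved-⟶s ps (step {xs} r) with ++⁻ xs ps
  ... | ps₁ , (p ∷ ps₂) = ++⁺ ps₁ (++⁺ (preserved p r) ps₂)

  preserved-⟶* : ∀ {S S'} → All P S → Star _⟶s_ S S' → All P S'
  preserved-⟶* ps ε = ps
  preserved-⟶* ps (r ◅ rs) = preserved-⟶* (preserved-⟶s ps r) rs

data δ-form : RTerm → Set where
  δ-form⁺ : ∀ {Ws} → All (_≡ rvar 0) Ws → δ-form (rlam (rapp (rvar 0) Ws))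

data Ω-form : RTerm → Set where
  Ω-form⁺ : ∀ {Vs Ds} → All (_≡ rvar 0) Vs → All δ-form Ds → Ω-form (rapp (rlam (rapp (rvar 0) Vs)) Ds)

∈T-δ : ∀ {u} → u ∈T δ → δ-form u
∈T-δ (Tlam (Tapp Tvar ws)) = δ-form⁺ (All.map (λ { Tvar → refl }) ws)

∈T-Ω : ∀ {t} → t ∈T Ω → Ω-form t
∈T-Ω (Tapp t∈ ds) with ∈T-δ t∈
... | δ-form⁺ ws = Ω-form⁺ ws (All.map ∈T-δ ds)

rvar-bag-normal : ∀ B1 {v B2 S} → All (_≡ rvar 0) (B1 ++ v ∷ B2) → ¬ (v ⟶ S)
rvar-bag-normal B1 ws r with All.lookup ws (Any-++⁺ʳ B1 (here refl))
rvar-bag-normal B1 ws () | refl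

δ-form-normal : ∀ {d S} → δ-form d → ¬ (d ⟶ S)
δ-form-normal (δ-form⁺ ws) (lamC (appL ()))
δ-form-normal (δ-form⁺ ws) (lamC (appR {B1 = B1} r)) = rvar-bag-normal B1 ws r

All-varCase-nothing : ∀ {P : RTerm → Set} {B} → All P B → All P (varCase nothing B)
All-varCase-nothing [] = []
All-varCase-nothing (p ∷ []) = p ∷ []
All-varCase-nothing (_ ∷ _ ∷ _) = []

δ-form-lsubstBag : ∀ Bs Vs → All (All δ-form) Bs → All (_≡ rvar 0) Vs → All (All δ-form) (lsubstBag 0 Bs Vs)
δ-form-lsubstBag [] [] _ _ = [] ∷ []
δ-form-lsubstBag [] (_ ∷ _) _ _ = []
δ-form-lsubstBag (_ ∷ _) [] _ _ = []
δ-form-lsubstBag (Bi ∷ Bs) (_ ∷ Vs) (ds ∷ dss) (refl ∷ ws) =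
  concatMap⁺ (All-varCase-nothing ds) (λ d → gmap⁺ (d ∷_) (δ-form-lsubstBag Bs Vs dss ws))

Ω-form-lsubstApp : ∀ Vs cs → All (All (All δ-form)) cs → All (_≡ rvar 0) Vs →
                   All Ω-form (lsubstApp 0 (rvar 0) Vs cs)
Ω-form-lsubstApp Vs [] _ ws = []
Ω-form-lsubstApp Vs ([] ∷ cs) (_ ∷ dsss) ws = Ω-form-lsubstApp Vs cs dsss ws
Ω-form-lsubstApp Vs ((B0 ∷ Bs) ∷ cs) ((ds ∷ dss) ∷ dsss) ws =
  ++⁺ (concatMap⁺ (All-varCase-nothing ds)
                  (λ { (δ-form⁺ ws′) → gmap⁺ (Ω-form⁺ ws′) (δ-form-lsubstBag Bs Vs dss ws) }))
      (Ω-form-lsubstApp Vs cs dsss ws)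

Ω-form-⟶ : ∀ {t T} → Ω-form t → t ⟶ T → All Ω-form T
Ω-form-⟶ (Ω-form⁺ {Vs} ws ds) βλ = Ω-form-lsubstApp Vs _ (wc-All ds (suc (length Vs))) ws
Ω-form-⟶ (Ω-form⁺ ws ds) (appL (lamC (appL ())))
Ω-form-⟶ (Ω-form⁺ ws ds) (appL (lamC (appR {B1 = B1} r))) = ⊥-elim (rvar-bag-normal B1 ws r)
Ω-form-⟶ (Ω-form⁺ ws ds) (appR {B1 = B1} r) =
  ⊥-elim (δ-form-normal (All.lookup ds (Any-++⁺ʳ B1 (here refl))) r)

NFT-Ω-empty : ∀ u → ¬ NFT Ω u
NFT-Ω-empty u (t , t∈ , u' , (S , t⟶*S , S-normal , u'∈S) , _)
  with All.lookup (preserved-⟶* Ω-form-⟶ (∈T-Ω t∈ ∷ []) t⟶*S) u'∈S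
... | Ω-form⁺ _ _ = All.lookup S-normal u'∈S _ βλ

≡T-refl : ∀ M → M ≡T M
≡T-refl M u = mk⇔ id id

NFT-var : ∀ k → NFT (var k) (rvar k)
NFT-var k = rvar k , Tvar , rvar k , (rvar k ∷ [] , ε , ((λ _ ()) ∷ []) , here refl) , rvar≈

var≢TΩ : ∀ k → ¬ (var k ≡T Ω)
var≢TΩ k var≡Ω = NFT-Ω-empty (rvar k) (Equivalence.to (var≡Ω (rvar k)) (NFT-var k))

rTrue : RTerm
rTrue = rlam (rlam (rvar 1))

NFT-True : NFT True rTrue
NFT-True = rTrue , Tlam (Tlam Tvar) , rTrue , (rTrue ∷ [] , ε , ((λ { _ (lamC (lamC ())) }) ∷ []) , here refl) ,
           rlam≈ (rlam≈ rvar≈)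

≈rTrue-closed : ∀ {k u} → u ≈ rTrue → ¬ Occ k u
≈rTrue-closed (rlam≈ (rlam≈ rvar≈)) (olam (olam ()))

∈T-pair-unused : ∀ M N {B} → All (_∈T pair (var 0) N) B → ¬ Any (Occ 0) B → All (_∈T pair M N) B
∈T-pair-unused M N [] _ = []
∈T-pair-unused M N (Tlam (Tapp (Tapp Tvar []) ns) ∷ ps) unused =
  Tlam (Tapp (Tapp Tvar []) ns) ∷ ∈T-pair-unused M N ps (unused ∘ there)
∈T-pair-unused M N (Tlam (Tapp (Tapp Tvar (Tvar ∷ _)) ns) ∷ ps) unused =
  ⊥-elim (unused (here (olam (oappL (oappR (here ovar))))))

NFT-app-pair-unused : ∀ P M N {u} → (∀ {u'} → u' ≈ u → ¬ Occ 0 u') →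
                      NFT (app P (pair (var 0) N)) u → NFT (app P (pair M N)) u
NFT-app-pair-unused P M N closed (rapp p B , Tapp p∈ bs , u' , (S , t⟶*S , S-normal , u'∈S) , u'≈u) =
  rapp p B , Tapp p∈ (∈T-pair-unused M N bs (unused ∘ oappR)) , u' , (S , t⟶*S , S-normal , u'∈S) , u'≈u
  where
  unused : ¬ Occ 0 (rapp p B)
  unused o = closed u'≈u (All.lookup (preserved-⟶* Occ-⟶ (o ∷ []) t⟶*S) u'∈S)

corollary4p2 : ¬ (∃ λ Por → ∀ M N →
                 ((¬ (M ≡T Ω) ⊎ ¬ (N ≡T Ω)) → app Por (pair M N) ≡T True)
                 × (M ≡T Ω → N ≡T Ω → app Por (pair M N) ≡T Ω))
corollary4p2 (Por , spec) =
  NFT-Ω-empty rTrue (Equivalence.to (Por⟨Ω,Ω⟩≡Ω rTrue)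
    (NFT-app-pair-unused Por Ω Ω ≈rTrue-closed (Equivalence.from (Por⟨x,Ω⟩≡True rTrue) NFT-True)))
  where
  Por⟨x,Ω⟩≡True : app Por (pair (var 0) Ω) ≡T True
  Por⟨x,Ω⟩≡True = proj₁ (spec (var 0) Ω) (inj₁ (var≢TΩ 0))

  Por⟨Ω,Ω⟩≡Ω : app Por (pair Ω Ω) ≡T Ω
  Por⟨Ω,Ω⟩≡Ω = proj₂ (spec Ω Ω) (≡T-refl Ω) (≡T-refl Ω)
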